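{- Let $G$ be any finite simple graph on $n\geq 2$ vertices other than the path on $4$ vertices, and let $G^c$ be its complement. Then $\max\{h(G),h(G^c)\}\geq \frac{1}{\lfloor n/2\rfloor}$.
   Context: For a graph $G=(V,E)$ and $X\subseteq V$ write $\bar X=V\setminus X$ and $\partial_G(X)$ for the set of edges of $G$ with one endpoint in $X$ and the other in $\bar X$. The volume of $X$ is $\mathrm{vol}_G(X)=\sum_{x\in X}\deg_G(x)$. The Cheeger ratio of a nonempty proper subset $X$ (with positive denominator) is $h_G(X)=\frac{|\partial_G(X)|}{\min\{\mathrm{vol}_G(X),\mathrm{vol}_G(\bar X)\}}$, and the Cheeger constant is $h(G)=\min_X h_G(X)$, the minimum over nonempty proper subsets $X\subset V$ for which $h_G(X)$ is defined. The complement $G^c$ has vertex set $V$ and contains exactly the pairs of distinct vertices that are not edges of $G$. -}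

module Defs where

open import Data.Nat using (ℕ; zero; suc; _+_; _*_; _⊓_; NonZero; ⌊_/2⌋)
open import Data.Fin using (Fin; zero; suc; _≟_)
open import Data.Bool using (Bool; true; false; not; _∧_; if_then_else_)
open import Data.Integer using (+_)
open import Data.Rational using (ℚ; _/_; _≤_)
open import Data.Product using (Σ; _×_)
open import Relation.Binary.PropositionalEquality using (_≡_)
open import Relation.Nullary using (does)
import Relation.Nullary
import Data.Empty
open import Function.Bundles using (_↔_; Inverse)

record Graph (n : ℕ) : Set where
  field
    adj    : Fin n → Fin n → Bool
    sym    : ∀ i j → adj i j ≡ adj j i
    irrefl : ∀ i → adj i i ≡ false
open Graph public

∑ : ∀ {n} → (Fin n → ℕ) → ℕ
∑ {zero}  f = 0
∑ {suc n} f = f zero + ∑ (λ i → f (suc i))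

b2n : Bool → ℕ
b2n true  = 1
b2n false = 0

complement : ∀ {n} → Graph n → Graph n
complement {n} G = record
  { adj = cadj
  ; sym = csym
  ; irrefl = cirr }
  where
  cadj : Fin n → Fin n → Bool
  cadj i j = not (does (i ≟ j)) ∧ not (adj G i j)


  csym : ∀ i j → cadj i j ≡ cadj j i
  csym i j with i ≟ j | j ≟ i
  ... | Relation.Nullary.yes _ | Relation.Nullary.yes _ = Relation.Binary.PropositionalEquality.refl
  ... | Relation.Nullary.yes p | Relation.Nullary.no q = Data.Empty.⊥-elim (q (Relation.Binary.PropositionalEquality.sym p))
  ... | Relation.Nullary.no p | Relation.Nullary.yes q = Data.Empty.⊥-elim (p (Relation.Binary.PropositionalEquality.sym q))
  ... | Relation.Nullary.no _ | Relation.Nullary.no _ = Relation.Binary.PropositionalEquality.cong not (sym G i j)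
  cirr : ∀ i → cadj i i ≡ false
  cirr i with i ≟ i
  ... | Relation.Nullary.yes _ = Relation.Binary.PropositionalEquality.refl
  ... | Relation.Nullary.no p = Data.Empty.⊥-elim (p Relation.Binary.PropositionalEquality.refl)

Subset : ℕ → Set
Subset n = Fin n → Bool

compl : ∀ {n} → Subset n → Subset n
compl X i = not (X i)

deg : ∀ {n} → Graph n → Fin n → ℕ
deg G x = ∑ (λ y → b2n (adj G x y))

vol : ∀ {n} → Graph n → Subset n → ℕ
vol G X = ∑ (λ x → if X x then deg G x else 0)

-- |∂_G(X)|: each edge with one end in X and the other outside X is counted
-- exactly once, via its orientation (x ∈ X, y ∉ X)
boundary : ∀ {n} → Graph n → Subset n → ℕ
boundary G X = ∑ (λ x → ∑ (λ y → b2n (X x ∧ (not (X y) ∧ adj G x y))))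

minVol : ∀ {n} → Graph n → Subset n → ℕ
minVol G X = vol G X ⊓ vol G (compl X)

NonemptyProper : ∀ {n} → Subset n → Set
NonemptyProper {n} X = Σ (Fin n) (λ x → X x ≡ true) × Σ (Fin n) (λ y → X y ≡ false)

cheegerRatio : ∀ {n} (G : Graph n) (X : Subset n) → .{{NonZero (minVol G X)}} → ℚ
cheegerRatio G X = (+ boundary G X) / minVol G X

CheegerDefined : ∀ {n} → Graph n → Set
CheegerDefined {n} G = Σ (Subset n) (λ X → NonemptyProper X × NonZero (minVol G X))

-- q ≤ h(G), where h(G) = min of h_G(X) over all nonempty proper X for which
-- h_G(X) is defined: h(G) exists and every such h_G(X) is ≥ q
CheegerAtLeast : ∀ {n} → Graph n → ℚ → Set
CheegerAtLeast {n} G q = CheegerDefined G ×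
  ((X : Subset n) → NonemptyProper X → (nz : NonZero (minVol G X)) →
   q ≤ cheegerRatio G X {{nz}})

record _≅_ {m n : ℕ} (G : Graph m) (H : Graph n) : Set where
  field
    bij      : Fin m ↔ Fin n
    preserve : ∀ i j → adj G i j ≡ adj H (Inverse.to bij i) (Inverse.to bij j)

P4adj : Fin 4 → Fin 4 → Bool
P4adj zero (suc zero) = true
P4adj (suc zero) zero = true
P4adj (suc zero) (suc (suc zero)) = true
P4adj (suc (suc zero)) (suc zero) = true
P4adj (suc (suc zero)) (suc (suc (suc zero))) = true
P4adj (suc (suc (suc zero))) (suc (suc zero)) = true
P4adj _ _ = false

P4 : Graph 4
P4 = record { adj = P4adj ; sym = s ; irrefl = r }
  where
  s : ∀ i j → P4adj i j ≡ P4adj j i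
  s zero zero = Relation.Binary.PropositionalEquality.refl
  s zero (suc zero) = Relation.Binary.PropositionalEquality.refl
  s zero (suc (suc zero)) = Relation.Binary.PropositionalEquality.refl
  s zero (suc (suc (suc zero))) = Relation.Binary.PropositionalEquality.refl
  s (suc zero) zero = Relation.Binary.PropositionalEquality.refl
  s (suc zero) (suc zero) = Relation.Binary.PropositionalEquality.refl
  s (suc zero) (suc (suc zero)) = Relation.Binary.PropositionalEquality.refl
  s (suc zero) (suc (suc (suc zero))) = Relation.Binary.PropositionalEquality.refl
  s (suc (suc zero)) zero = Relation.Binary.PropositionalEquality.refl
  s (suc (suc zero)) (suc zero) = Relation.Binary.PropositionalEquality.refl
  s (suc (suc zero)) (suc (suc zero)) = Relation.Binary.PropositionalEquality.refl
  s (suc (suc zero)) (suc (suc (suc zero))) = Relation.Binary.PropositionalEquality.refl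
  s (suc (suc (suc zero))) zero = Relation.Binary.PropositionalEquality.refl
  s (suc (suc (suc zero))) (suc zero) = Relation.Binary.PropositionalEquality.refl
  s (suc (suc (suc zero))) (suc (suc zero)) = Relation.Binary.PropositionalEquality.refl
  s (suc (suc (suc zero))) (suc (suc (suc zero))) = Relation.Binary.PropositionalEquality.refl
  r : ∀ i → P4adj i i ≡ false
  r zero = Relation.Binary.PropositionalEquality.refl
  r (suc zero) = Relation.Binary.PropositionalEquality.refl
  r (suc (suc zero)) = Relation.Binary.PropositionalEquality.refl
  r (suc (suc (suc zero))) = Relation.Binary.PropositionalEquality.refl

{-# OPTIONS --safe #-}
-- Call a graph H expanding if |∂X| ≥ min(|X|, |Xᶜ|) for every vertex set X. If S is the smaller
-- side of a cut of an expanding graph, a vertex of S has at most |S| - 1 neighbours inside S, so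
-- vol S ≤ |S|(|S| - 1) + |∂S| ≤ |S|·|∂S| ≤ ⌊n/2⌋·|∂S|; hence h(H) ≥ 1/⌊n/2⌋.
--
-- It remains to see that G or Gᶜ is expanding. Let X be a sparse cut of G, |∂_G X| < min(|X|, |Xᶜ|),
-- and Y any cut; let a, b, c, d be the sizes of Y ∩ X, Yᶜ ∩ X, Y ∩ Xᶜ, Yᶜ ∩ Xᶜ. Every pair joining
-- Y ∩ X to Yᶜ ∩ Xᶜ or Y ∩ Xᶜ to Yᶜ ∩ X is an edge of G crossing X or an edge of Gᶜ crossing Y, so
-- ad + bc ≤ |∂_G X| + |∂_Gᶜ Y|. Since min(a + b, c + d) + min(a + c, b + d) ≤ ad + bc + 1 unless
-- a = b = c = d = 1, this makes Gᶜ expanding when n ≠ 4. On four vertices, evaluation over all 64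
-- graphs shows that only the copies of P4 have neither G nor Gᶜ expanding.

module Submission where

open import Defs renaming (sym to adj-sym; irrefl to adj-irrefl)
open import Data.Nat using (ℕ; zero; suc; pred; _+_; _*_; _≤_; _<_; _⊓_; z≤n; s≤s; NonZero; >-nonZero; ⌊_/2⌋)
open import Data.Nat.Properties
open import Data.Nat.Tactic.RingSolver
open import Data.Fin using (Fin; zero; suc)
open import Data.Bool using (Bool; true; false; not; _∧_; if_then_else_)
open import Data.Bool.Properties as Bool using (∧-comm; not-involutive)
import Data.Fin.Properties as Fin
open import Data.Fin.Patterns using (0F; 1F; 2F; 3F; 4F; 5F)
open import Data.Fin.Permutation using (Permutation′; transpose; _∘ₚ_; _⟨$⟩ʳ_)
open import Data.Integer using (+_)
import Data.Integer as ℤ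
import Data.Integer.Properties as ℤ
open import Data.Rational using (_/_)
import Data.Rational as ℚ
open import Data.Rational.Properties using (toℚᵘ-cancel-≤; toℚᵘ-fromℚᵘ)
open import Data.Rational.Unnormalised using (mkℚᵘ; *≤*)
import Data.Rational.Unnormalised.Properties as ℚᵘ
open import Data.Product using (Σ; _,_)
open import Data.Sum as Sum using (_⊎_; inj₁; inj₂)
open import Function using (_∘_)
open import Data.List using (List; _∷_; []; [_]; allFin)
open import Data.List.Effectful using (monad)
open import Data.List.Relation.Unary.Any using (Any; any?; satisfied)
open import Effect.Monad using (RawMonad)
open import Level using (0ℓ)
open import Data.Empty using (⊥-elim)
open import Data.Vec using (Vec; lookup; tabulate)
open import Data.Vec.Properties using (lookup∘tabulate)
open import Data.Fin.Subset.Properties using (anySubset?)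
open import Relation.Nullary using (¬_; Dec; yes; no; ¬?; does)
open import Relation.Nullary.Decidable using (dec-false; _⊎-dec_; from-no; decidable-stable)
open import Relation.Binary.PropositionalEquality
  using (_≡_; _≢_; _≗_; refl; sym; trans; cong; cong₂; subst; subst₂; module ≡-Reasoning)
open import Algebra.Properties.Semiring.Sum +-*-semiring
  using (sum; sum-cong-≗; *-distribˡ-sum; *-distribʳ-sum)
  renaming (∑-distrib-+ to sum-distrib-+; ∑-comm to sum-comm)

open RawMonad (monad {0ℓ}) using (_>>=_)

private
  variable
    n : ℕ

∑-cong : {f g : Fin n → ℕ} → f ≗ g → ∑ f ≡ ∑ g
∑-cong {zero}  f≗g = refl
∑-cong {suc n} f≗g = cong₂ _+_ (f≗g zero) (∑-cong (f≗g ∘ suc))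

∑-mono-≤ : {f g : Fin n → ℕ} → (∀ i → f i ≤ g i) → ∑ f ≤ ∑ g
∑-mono-≤ {zero}  f≤g = z≤n
∑-mono-≤ {suc n} f≤g = +-mono-≤ (f≤g zero) (∑-mono-≤ (f≤g ∘ suc))

∑-const : ∀ n c → ∑ {n} (λ _ → c) ≡ n * c
∑-const zero    c = refl
∑-const (suc n) c = cong (_+_ c) (∑-const n c)

term≤∑ : (f : Fin n → ℕ) (i : Fin n) → f i ≤ ∑ f
term≤∑ f zero    = m≤m+n (f zero) _
term≤∑ f (suc i) = m≤n⇒m≤o+n (f zero) (term≤∑ (f ∘ suc) i)

∑≡sum : (f : Fin n → ℕ) → ∑ f ≡ sum f
∑≡sum {zero}  f = refl
∑≡sum {suc n} f = cong (_+_ (f zero)) (∑≡sum (f ∘ suc))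

∑∑≡sum-sum : ∀ {m} (f : Fin m → Fin n → ℕ) → ∑ (λ i → ∑ (f i)) ≡ sum (λ i → sum (f i))
∑∑≡sum-sum f = trans (∑≡sum (λ i → ∑ (f i))) (sum-cong-≗ (∑≡sum ∘ f))

∑-distrib-+ : (f g : Fin n → ℕ) → ∑ (λ i → f i + g i) ≡ ∑ f + ∑ g
∑-distrib-+ f g = trans (∑≡sum (λ i → f i + g i))
  (trans (sum-distrib-+ f g) (sym (cong₂ _+_ (∑≡sum f) (∑≡sum g))))

∑∑-distrib-+ : ∀ {m} (f g : Fin m → Fin n → ℕ) →
  ∑ (λ i → ∑ (λ j → f i j + g i j)) ≡ ∑ (λ i → ∑ (f i)) + ∑ (λ i → ∑ (g i))
∑∑-distrib-+ f g = trans (∑-cong (λ i → ∑-distrib-+ (f i) (g i))) (∑-distrib-+ (λ i → ∑ (f i)) (λ i → ∑ (g i)))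

∑-comm : ∀ {m} (f : Fin m → Fin n → ℕ) → ∑ (λ i → ∑ (f i)) ≡ ∑ (λ j → ∑ (λ i → f i j))
∑-comm f = trans (∑∑≡sum-sum f) (trans (sum-comm f) (sym (∑∑≡sum-sum (λ j i → f i j))))

∑-*ˡ : ∀ c (f : Fin n → ℕ) → ∑ (λ i → c * f i) ≡ c * ∑ f
∑-*ˡ c f = trans (∑≡sum (λ i → c * f i)) (trans (sym (*-distribˡ-sum c f)) (cong (c *_) (sym (∑≡sum f))))

∑*∑ : ∀ {m} (f : Fin m → ℕ) (g : Fin n → ℕ) → ∑ f * ∑ g ≡ ∑ (λ i → ∑ (λ j → f i * g j))
∑*∑ f g = begin
  ∑ f * ∑ g                           ≡⟨ cong₂ _*_ (∑≡sum f) (∑≡sum g) ⟩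
  sum f * sum g                       ≡⟨ *-distribʳ-sum (sum g) f ⟩
  sum (λ i → f i * sum g)             ≡⟨ sum-cong-≗ (λ i → *-distribˡ-sum (f i) g) ⟩
  sum (λ i → sum (λ j → f i * g j))   ≡⟨ sym (∑∑≡sum-sum (λ i j → f i * g j)) ⟩
  ∑ (λ i → ∑ (λ j → f i * g j))       ∎
  where open ≡-Reasoning

∑∑-symmetrised≤ : (w f : Fin n → Fin n → ℕ) → (∀ x y → w x y + w y x ≤ 1) →
  ∑ (λ x → ∑ (λ y → w x y * (f x y + f y x))) ≤ ∑ (λ x → ∑ (f x))
∑∑-symmetrised≤ w f w≤1 = begin
  ∑ (λ x → ∑ (λ y → w x y * (f x y + f y x)))
    ≡⟨ ∑-cong (λ x → ∑-cong (λ y → *-distribˡ-+ (w x y) (f x y) (f y x))) ⟩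
  ∑ (λ x → ∑ (λ y → w x y * f x y + w x y * f y x))
    ≡⟨ ∑∑-distrib-+ (λ x y → w x y * f x y) (λ x y → w x y * f y x) ⟩
  ∑ (λ x → ∑ (λ y → w x y * f x y)) + ∑ (λ x → ∑ (λ y → w x y * f y x))
    ≡⟨ cong (_+_ (∑ (λ x → ∑ (λ y → w x y * f x y)))) (∑-comm (λ x y → w x y * f y x)) ⟩
  ∑ (λ x → ∑ (λ y → w x y * f x y)) + ∑ (λ x → ∑ (λ y → w y x * f x y))
    ≡⟨ ∑∑-distrib-+ (λ x y → w x y * f x y) (λ x y → w y x * f x y) ⟨
  ∑ (λ x → ∑ (λ y → w x y * f x y + w y x * f x y))
    ≡⟨ ∑-cong (λ x → ∑-cong (λ y → *-distribʳ-+ (f x y) (w x y) (w y x))) ⟨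
  ∑ (λ x → ∑ (λ y → (w x y + w y x) * f x y))
    ≤⟨ ∑-mono-≤ (λ x → ∑-mono-≤ (λ y → *-monoˡ-≤ (f x y) (w≤1 x y))) ⟩
  ∑ (λ x → ∑ (λ y → 1 * f x y))
    ≡⟨ ∑-cong (λ x → ∑-cong (λ y → *-identityˡ (f x y))) ⟩
  ∑ (λ x → ∑ (f x))                                ∎
  where open ≤-Reasoning

b2n+b2n-not : ∀ b → b2n b + b2n (not b) ≡ 1
b2n+b2n-not true  = refl
b2n+b2n-not false = refl

_∩_ : Subset n → Subset n → Subset n
(X ∩ Y) i = X i ∧ Y i

card : Subset n → ℕ
card X = ∑ (b2n ∘ X)

card-cong : {X Y : Subset n} → X ≗ Y → card X ≡ card Y
card-cong X≗Y = ∑-cong (cong b2n ∘ X≗Y)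

card+card-compl : (X : Subset n) → card X + card (compl X) ≡ n
card+card-compl {n} X = begin
  card X + card (compl X)                ≡⟨ ∑-distrib-+ (b2n ∘ X) (b2n ∘ compl X) ⟨
  ∑ (λ i → b2n (X i) + b2n (not (X i)))  ≡⟨ ∑-cong (b2n+b2n-not ∘ X) ⟩
  ∑ {n} (λ _ → 1)                        ≡⟨ ∑-const n 1 ⟩
  n * 1                                  ≡⟨ *-identityʳ n ⟩
  n                                      ∎
  where open ≡-Reasoning

card-∩-split : (X Y : Subset n) → card X ≡ card (X ∩ Y) + card (X ∩ compl Y)
card-∩-split X Y = trans (∑-cong (λ i → split (X i) (Y i))) (∑-distrib-+ (b2n ∘ (X ∩ Y)) (b2n ∘ (X ∩ compl Y)))
  where
  split : ∀ p q → b2n p ≡ b2n (p ∧ q) + b2n (p ∧ not q)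
  split true  true  = refl
  split true  false = refl
  split false q     = refl

card-∩-comm : (X Y : Subset n) → card (X ∩ Y) ≡ card (Y ∩ X)
card-∩-comm X Y = card-cong (λ i → ∧-comm (X i) (Y i))

card-nonempty : (X : Subset n) (x : Fin n) → X x ≡ true → 0 < card X
card-nonempty X x x∈X = ≤-trans (≤-reflexive (cong b2n (sym x∈X))) (term≤∑ (b2n ∘ X) x)

card-∩<card : (X Y : Subset n) (x : Fin n) → X x ≡ true → Y x ≡ false → card (X ∩ Y) < card X
card-∩<card X Y x x∈X x∉Y = begin-strict
  card (X ∩ Y)                          <⟨ m<m+n (card (X ∩ Y)) (card-nonempty (X ∩ compl Y) x x∈X∖Y) ⟩
  card (X ∩ Y) + card (X ∩ compl Y)     ≡⟨ card-∩-split X Y ⟨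
  card X                                ∎
  where
  open ≤-Reasoning
  x∈X∖Y : X x ∧ not (Y x) ≡ true
  x∈X∖Y = cong₂ (λ p q → p ∧ not q) x∈X x∉Y

0<card⊓card : (X : Subset n) → NonemptyProper X → 0 < card X ⊓ card (compl X)
0<card⊓card X ((x , x∈X) , (y , y∉X)) =
  ⊓-glb (card-nonempty X x x∈X) (card-nonempty (compl X) y (cong not y∉X))

crossing : Graph n → Subset n → Fin n → Fin n → ℕ
crossing H X x y = b2n (X x ∧ (not (X y) ∧ adj H x y))

boundary-cong : (G H : Graph n) {X Y : Subset n} → (∀ i j → adj G i j ≡ adj H i j) → X ≗ Y →
  boundary G X ≡ boundary H Y
boundary-cong G H G≡H X≗Y = ∑-cong (λ i → ∑-cong (λ j →
  cong b2n (cong₂ _∧_ (X≗Y i) (cong₂ _∧_ (cong not (X≗Y j)) (G≡H i j)))))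

boundary-compl : (H : Graph n) (X : Subset n) → boundary H (compl X) ≡ boundary H X
boundary-compl H X = trans (∑-comm (crossing H (compl X))) (∑-cong (λ y → ∑-cong (λ x → reverse x y)))
  where
  reverse : ∀ x y → crossing H (compl X) x y ≡ crossing H X y x
  reverse x y rewrite adj-sym H x y with X x | X y
  ... | true  | true  = refl
  ... | true  | false = refl
  ... | false | true  = refl
  ... | false | false = refl

outDeg : Graph n → Subset n → Fin n → ℕ
outDeg H X x = card (compl X ∩ adj H x)

deg-split : (H : Graph n) (X : Subset n) (x : Fin n) → deg H x ≡ card (X ∩ adj H x) + outDeg H X x
deg-split H X x = trans (card-∩-split (adj H x) X)
  (cong₂ _+_ (card-∩-comm (adj H x) X) (card-∩-comm (adj H x) (compl X)))

boundary≡∑outDeg : (H : Graph n) (X : Subset n) → boundary H X ≡ ∑ (λ x → if X x then outDeg H X x else 0)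
boundary≡∑outDeg {n} H X = ∑-cong outside
  where
  outside : ∀ x → ∑ (crossing H X x) ≡ (if X x then outDeg H X x else 0)
  outside x with X x
  ... | true  = refl
  ... | false = trans (∑-const n 0) (*-zeroʳ n)

boundary≤vol : (H : Graph n) (X : Subset n) → boundary H X ≤ vol H X
boundary≤vol H X = ≤-trans (≤-reflexive (boundary≡∑outDeg H X)) (∑-mono-≤ outDeg≤deg)
  where
  outDeg≤deg : ∀ x → (if X x then outDeg H X x else 0) ≤ (if X x then deg H x else 0)
  outDeg≤deg x with X x
  ... | true  = ≤-trans (m≤n+m (outDeg H X x) _) (≤-reflexive (sym (deg-split H X x)))
  ... | false = z≤n

boundary≤minVol : (H : Graph n) (X : Subset n) → boundary H X ≤ minVol H X
boundary≤minVol H X = ⊓-glb (boundary≤vol H X)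
  (≤-trans (≤-reflexive (sym (boundary-compl H X))) (boundary≤vol H (compl X)))

vol≤card*boundary : (H : Graph n) (S : Subset n) .{{_ : NonZero (card S)}} →
  card S ≤ boundary H S → vol H S ≤ card S * boundary H S
vol≤card*boundary H S s≤∂ = begin
  vol H S                                                     ≤⟨ ∑-mono-≤ deg≤ ⟩
  ∑ (λ x → k * b2n (S x) + (if S x then outDeg H S x else 0)) ≡⟨ ∑-distrib-+ (λ x → k * b2n (S x)) _ ⟩
  ∑ (λ x → k * b2n (S x)) + ∑ (λ x → if S x then outDeg H S x else 0)
    ≡⟨ cong₂ _+_ (∑-*ˡ k (b2n ∘ S)) (sym (boundary≡∑outDeg H S)) ⟩
  k * card S + boundary H S                                   ≤⟨ +-monoˡ-≤ (boundary H S) (*-monoʳ-≤ k s≤∂) ⟩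
  k * boundary H S + boundary H S                             ≡⟨ +-comm (k * boundary H S) (boundary H S) ⟩
  suc k * boundary H S                                        ≡⟨ cong (_* boundary H S) (suc-pred (card S)) ⟩
  card S * boundary H S                                       ∎
  where
  open ≤-Reasoning
  k = pred (card S)
  deg≤ : ∀ x → (if S x then deg H x else 0) ≤ k * b2n (S x) + (if S x then outDeg H S x else 0)
  deg≤ x with S x in x∈S
  ... | true  = begin
    deg H x                                 ≡⟨ deg-split H S x ⟩
    card (S ∩ adj H x) + outDeg H S x       ≤⟨ +-monoˡ-≤ (outDeg H S x) (<⇒≤pred (card-∩<card S (adj H x) x x∈S (adj-irrefl H x))) ⟩
    k + outDeg H S x                        ≡⟨ cong (_+ outDeg H S x) (*-identityʳ k) ⟨
    k * 1 + outDeg H S x                    ∎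
  ... | false = z≤n

Expanding : Graph n → Set
Expanding {n} H = (X : Subset n) → card X ⊓ card (compl X) ≤ boundary H X

expanding-cong : (G H : Graph n) → (∀ i j → adj G i j ≡ adj H i j) → Expanding G → Expanding H
expanding-cong G H G≡H expanding X = subst (_ ≤_) (boundary-cong G H {X} {X} G≡H (λ _ → refl)) (expanding X)

m≤n⇒m≤⌊m+n/2⌋ : ∀ {m n} → m ≤ n → m ≤ ⌊ m + n /2⌋
m≤n⇒m≤⌊m+n/2⌋ {m} m≤n = ≤-trans (≤-reflexive (n≡⌊n+n/2⌋ m)) (⌊n/2⌋-mono (+-monoʳ-≤ m m≤n))

vol≤⌊n/2⌋*boundary : (H : Graph n) → Expanding H → (S : Subset n) .{{_ : NonZero (card S)}} →
  card S ≤ card (compl S) → vol H S ≤ ⌊ n /2⌋ * boundary H S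
vol≤⌊n/2⌋*boundary {n} H expanding S s≤sᶜ = begin
  vol H S                ≤⟨ vol≤card*boundary H S (≤-trans (≤-reflexive (sym (m≤n⇒m⊓n≡m s≤sᶜ))) (expanding S)) ⟩
  card S * boundary H S  ≤⟨ *-monoˡ-≤ (boundary H S) s≤⌊n/2⌋ ⟩
  ⌊ n /2⌋ * boundary H S ∎
  where
  open ≤-Reasoning
  s≤⌊n/2⌋ : card S ≤ ⌊ n /2⌋
  s≤⌊n/2⌋ = ≤-trans (m≤n⇒m≤⌊m+n/2⌋ s≤sᶜ) (≤-reflexive (cong ⌊_/2⌋ (card+card-compl S)))

minVol≤⌊n/2⌋*boundary : (H : Graph n) → Expanding H → (X : Subset n) → NonemptyProper X →
  minVol H X ≤ ⌊ n /2⌋ * boundary H X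
minVol≤⌊n/2⌋*boundary {n} H expanding X ((x , x∈X) , (y , y∉X)) with ≤-total (card X) (card (compl X))
... | inj₁ x≤xᶜ = ≤-trans (m⊓n≤m _ _)
  (vol≤⌊n/2⌋*boundary H expanding X {{>-nonZero (card-nonempty X x x∈X)}} x≤xᶜ)
... | inj₂ xᶜ≤x = ≤-trans (m⊓n≤n _ _) (begin
  vol H (compl X)                  ≤⟨ vol≤⌊n/2⌋*boundary H expanding (compl X) {{>-nonZero y∈Xᶜ}} xᶜ≤xᶜᶜ ⟩
  ⌊ n /2⌋ * boundary H (compl X)   ≡⟨ cong (⌊ n /2⌋ *_) (boundary-compl H X) ⟩
  ⌊ n /2⌋ * boundary H X           ∎)
  where
  open ≤-Reasoning
  y∈Xᶜ : 0 < card (compl X)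
  y∈Xᶜ = card-nonempty (compl X) y (cong not y∉X)
  xᶜ≤xᶜᶜ : card (compl X) ≤ card (compl (compl X))
  xᶜ≤xᶜᶜ = ≤-trans xᶜ≤x (≤-reflexive (card-cong (sym ∘ not-involutive ∘ X)))

*≤*⇒/≤/ : ∀ a b c d .{{_ : NonZero c}} .{{_ : NonZero d}} → a * d ≤ b * c → + a / c ℚ.≤ + b / d
*≤*⇒/≤/ a b (suc c) (suc d) ad≤bc = toℚᵘ-cancel-≤
  (ℚᵘ.≤-respˡ-≃ (ℚᵘ.≃-sym (toℚᵘ-fromℚᵘ (mkℚᵘ (+ a) c)))
  (ℚᵘ.≤-respʳ-≃ (ℚᵘ.≃-sym (toℚᵘ-fromℚᵘ (mkℚᵘ (+ b) d)))
  (*≤* (subst₂ ℤ._≤_ (ℤ.pos-* a (suc d)) (ℤ.pos-* b (suc c)) (ℤ.+≤+ ad≤bc)))))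

expanding⇒cheegerAtLeast : ∀ {m} (H : Graph (suc (suc m))) → Expanding H →
  CheegerAtLeast H (+ 1 / ⌊ suc (suc m) /2⌋)
expanding⇒cheegerAtLeast {m} H expanding = (first , first-proper , >-nonZero 0<minVol) , bound
  where
  first : Subset (suc (suc m))
  first zero    = true
  first (suc _) = false
  first-proper : NonemptyProper first
  first-proper = (zero , refl) , (suc zero , refl)
  0<minVol : 0 < minVol H first
  0<minVol = ≤-trans (0<card⊓card first first-proper) (≤-trans (expanding first) (boundary≤minVol H first))
  bound : (X : Subset (suc (suc m))) → NonemptyProper X → (nz : NonZero (minVol H X)) →
    + 1 / ⌊ suc (suc m) /2⌋ ℚ.≤ cheegerRatio H X {{nz}}
  bound X proper nz = *≤*⇒/≤/ 1 (boundary H X) ⌊ suc (suc m) /2⌋ (minVol H X) {{_}} {{nz}}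
    (≤-trans (≤-reflexive (*-identityˡ (minVol H X)))
    (≤-trans (minVol≤⌊n/2⌋*boundary H expanding X proper)
    (≤-reflexive (*-comm ⌊ suc (suc m) /2⌋ (boundary H X)))))

SparseCut : Graph n → Subset n → Set
SparseCut H X = boundary H X < card X ⊓ card (compl X)

sparseCut-cong : (H : Graph n) {X Y : Subset n} → X ≗ Y → SparseCut H X → SparseCut H Y
sparseCut-cong H X≗Y = subst₂ _<_ (boundary-cong H H (λ _ _ → refl) X≗Y)
  (cong₂ _⊓_ (card-cong X≗Y) (card-cong (cong not ∘ X≗Y)))

expanding⊎sparseCut : (H : Graph n) → Expanding H ⊎ Σ (Subset n) (SparseCut H)
expanding⊎sparseCut H with anySubset? (λ v → boundary H (lookup v) <? card (lookup v) ⊓ card (compl (lookup v)))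
... | yes (v , sparse) = inj₂ (lookup v , sparse)
... | no noSparse      = inj₁ λ X → ≮⇒≥ λ sparse →
  noSparse (tabulate X , sparseCut-cong H (sym ∘ lookup∘tabulate X) sparse)

expanding? : (H : Graph n) → Dec (Expanding H)
expanding? H with expanding⊎sparseCut H
... | inj₁ expanding     = yes expanding
... | inj₂ (X , sparse) = no λ expanding → <⇒≱ sparse (expanding X)

+-mono-≤-with-slack : ∀ {m₁ m₂ p q r} → m₁ ≤ p → m₂ ≤ q → ∀ k → p + q + k ≡ r → m₁ + m₂ ≤ r
+-mono-≤-with-slack {p = p} {q} m₁≤p m₂≤q k refl = ≤-trans (+-mono-≤ m₁≤p m₂≤q) (m≤m+n (p + q) k)

min-sides≤1+cross : ∀ a b c d → 0 < a + b → 0 < c + d → 0 < a + c → 0 < b + d → a + b + (c + d) ≢ 4 →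
  (a + b) ⊓ (c + d) + (a + c) ⊓ (b + d) ≤ suc (a * d + c * b)
min-sides≤1+cross zero zero _ _ () _ _ _ _
min-sides≤1+cross zero (suc b) zero _ _ _ () _ _
min-sides≤1+cross zero (suc b) (suc c) d _ _ _ _ _ =
  +-mono-≤-with-slack (m⊓n≤m (suc b) (suc c + d)) (m⊓n≤m (suc c) (suc b + d)) (b * c) (solve (b ∷ c ∷ d ∷ []))
min-sides≤1+cross (suc a) zero c zero _ _ _ () _
min-sides≤1+cross (suc a) (suc b) zero zero _ () _ _ _
min-sides≤1+cross (suc a) (suc b) (suc c) zero _ _ _ _ _ =
  +-mono-≤-with-slack (m⊓n≤n (suc a + suc b) (suc c + 0)) (m⊓n≤n (suc a + suc c) (suc b + 0)) (b * c) (solve (a ∷ b ∷ c ∷ []))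
min-sides≤1+cross (suc a) zero c (suc d) _ _ _ _ _ =
  +-mono-≤-with-slack (m⊓n≤m (suc a + 0) (c + suc d)) (m⊓n≤n (suc a + c) (0 + suc d)) (a * d) (solve (a ∷ c ∷ d ∷ []))
min-sides≤1+cross (suc a) (suc b) zero (suc d) _ _ _ _ _ =
  +-mono-≤-with-slack (m⊓n≤n (suc a + suc b) (0 + suc d)) (m⊓n≤m (suc a + 0) (suc b + suc d)) (a * d) (solve (a ∷ b ∷ d ∷ []))
min-sides≤1+cross (suc a) (suc b) (suc c) (suc (suc d)) _ _ _ _ _ =
  +-mono-≤-with-slack (m⊓n≤m (suc a + suc b) (suc c + suc (suc d))) (m⊓n≤m (suc a + suc c) (suc b + suc (suc d)))
    (a * d + b * c + d) (solve (a ∷ b ∷ c ∷ d ∷ []))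
min-sides≤1+cross (suc (suc a)) (suc b) (suc c) 1 _ _ _ _ _ =
  +-mono-≤-with-slack (m⊓n≤n (suc (suc a) + suc b) (suc c + 1)) (m⊓n≤n (suc (suc a) + suc c) (suc b + 1))
    (a + b * c) (solve (a ∷ b ∷ c ∷ []))
min-sides≤1+cross 1 (suc b) (suc (suc c)) 1 _ _ _ _ _ =
  +-mono-≤-with-slack (m⊓n≤m (1 + suc b) (suc (suc c) + 1)) (m⊓n≤n (1 + suc (suc c)) (suc b + 1))
    (b * c + c) (solve (b ∷ c ∷ []))
min-sides≤1+cross 1 (suc (suc b)) 1 1 _ _ _ _ _ =
  +-mono-≤-with-slack (m⊓n≤n (1 + suc (suc b)) (1 + 1)) (m⊓n≤m (1 + 1) (suc (suc b) + 1)) b (solve (b ∷ []))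
min-sides≤1+cross 1 1 1 1 _ _ _ _ n≢4 = ⊥-elim (n≢4 refl)

different-sides⇒≢ : (X : Subset n) {x y : Fin n} → X x ≡ true → X y ≡ false → x ≢ y
different-sides⇒≢ X x∈X y∉X refl with () ← trans (sym x∈X) y∉X

adj-complement : (G : Graph n) {x y : Fin n} → x ≢ y → adj (complement G) x y ≡ not (adj G x y)
adj-complement G {x} {y} x≢y = cong (λ b → not b ∧ not (adj G x y)) (dec-false (x Fin.≟ y) x≢y)

complement-cong : (G H : Graph n) → (∀ i j → adj G i j ≡ adj H i j) →
  ∀ i j → adj (complement G) i j ≡ adj (complement H) i j
complement-cong G H G≡H i j = cong (λ b → not (does (i Fin.≟ j)) ∧ not b) (G≡H i j)

edge-in-G-or-Gᶜ : (G : Graph n) {x y : Fin n} → x ≢ y → 1 ≤ b2n (adj (complement G) x y) + b2n (adj G x y)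
edge-in-G-or-Gᶜ G {x} {y} x≢y rewrite adj-complement G x≢y =
  ≤-reflexive (sym (trans (+-comm (b2n (not (adj G x y))) _) (b2n+b2n-not (adj G x y))))

cells-pair≤ : (G : Graph n) (X Y : Subset n) (x y : Fin n) →
  b2n ((Y ∩ X) x) * b2n ((compl Y ∩ compl X) y) + b2n ((Y ∩ compl X) x) * b2n ((compl Y ∩ X) y)
  ≤ crossing (complement G) Y x y + b2n (Y x ∧ not (Y y)) * (crossing G X x y + crossing G X y x)
cells-pair≤ G X Y x y rewrite adj-sym G y x with Y x | Y y | X x in x-side | X y in y-side
... | false | _     | _     | _     = z≤n
... | true  | true  | true  | _     = z≤n
... | true  | true  | false | _     = z≤n
... | true  | false | true  | true  = z≤n
... | true  | false | false | false = z≤n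
... | true  | false | true  | false = ≤-trans (edge-in-G-or-Gᶜ G (different-sides⇒≢ X x-side y-side))
  (+-monoʳ-≤ (b2n (adj (complement G) x y)) (≤-reflexive (sym (trans (*-identityˡ (g + 0)) (+-identityʳ g)))))
  where g = b2n (adj G x y)
... | true  | false | false | true  = ≤-trans (edge-in-G-or-Gᶜ G (different-sides⇒≢ X y-side x-side ∘ sym))
  (+-monoʳ-≤ (b2n (adj (complement G) x y)) (≤-reflexive (sym (*-identityˡ (b2n (adj G x y))))))

cells-product≤boundaries : (G : Graph n) (X Y : Subset n) →
  card (Y ∩ X) * card (compl Y ∩ compl X) + card (Y ∩ compl X) * card (compl Y ∩ X)
  ≤ boundary (complement G) Y + boundary G X
cells-product≤boundaries G X Y = begin
  card A * card D + card C * card B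
    ≡⟨ cong₂ _+_ (∑*∑ (b2n ∘ A) (b2n ∘ D)) (∑*∑ (b2n ∘ C) (b2n ∘ B)) ⟩
  ∑ (λ x → ∑ (λ y → [A][D] x y)) + ∑ (λ x → ∑ (λ y → [C][B] x y))
    ≡⟨ ∑∑-distrib-+ [A][D] [C][B] ⟨
  ∑ (λ x → ∑ (λ y → [A][D] x y + [C][B] x y))
    ≤⟨ ∑-mono-≤ (λ x → ∑-mono-≤ (cells-pair≤ G X Y x)) ⟩
  ∑ (λ x → ∑ (λ y → crossing (complement G) Y x y + w x y * (crossing G X x y + crossing G X y x)))
    ≡⟨ ∑∑-distrib-+ (crossing (complement G) Y) (λ x y → w x y * (crossing G X x y + crossing G X y x)) ⟩
  boundary (complement G) Y + ∑ (λ x → ∑ (λ y → w x y * (crossing G X x y + crossing G X y x)))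
    ≤⟨ +-monoʳ-≤ (boundary (complement G) Y) (∑∑-symmetrised≤ w (crossing G X) (λ x y → one-way (Y x) (Y y))) ⟩
  boundary (complement G) Y + boundary G X  ∎
  where
  open ≤-Reasoning
  A B C D : Subset _
  A = Y ∩ X
  B = compl Y ∩ X
  C = Y ∩ compl X
  D = compl Y ∩ compl X
  [A][D] [C][B] w : Fin _ → Fin _ → ℕ
  [A][D] x y = b2n (A x) * b2n (D y)
  [C][B] x y = b2n (C x) * b2n (B y)
  w x y = b2n (Y x ∧ not (Y y))
  one-way : ∀ p q → b2n (p ∧ not q) + b2n (q ∧ not p) ≤ 1
  one-way true  true  = z≤n
  one-way true  false = ≤-refl
  one-way false true  = ≤-refl
  one-way false false = z≤n

sparseCut⇒complement-expanding : (G : Graph n) (X : Subset n) → SparseCut G X → n ≢ 4 →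
  Expanding (complement G)
sparseCut⇒complement-expanding {n} G X sparse n≢4 Y with card Y ⊓ card (compl Y) ≟ 0
... | yes trivial = ≤-trans (≤-reflexive trivial) z≤n
... | no nontrivial = begin
  card Y ⊓ card (compl Y)  ≡⟨ cong₂ _⊓_ |Y| |Yᶜ| ⟩
  (a + c) ⊓ (b + d)        ≤⟨ +-cancelʳ-≤ (suc ∂X) _ ∂ᶜY (begin
    (a + c) ⊓ (b + d) + suc ∂X               ≤⟨ +-monoʳ-≤ ((a + c) ⊓ (b + d)) sparse′ ⟩
    (a + c) ⊓ (b + d) + (a + b) ⊓ (c + d)    ≡⟨ +-comm ((a + c) ⊓ (b + d)) _ ⟩
    (a + b) ⊓ (c + d) + (a + c) ⊓ (b + d)    ≤⟨ min-sides≤1+cross a b c d 0<|X| 0<|Xᶜ| 0<|Y| 0<|Yᶜ| cells≢4 ⟩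
    suc (a * d + c * b)                      ≤⟨ s≤s (cells-product≤boundaries G X Y) ⟩
    suc (∂ᶜY + ∂X)                           ≡⟨ +-suc ∂ᶜY ∂X ⟨
    ∂ᶜY + suc ∂X                             ∎) ⟩
  ∂ᶜY                      ∎
  where
  open ≤-Reasoning
  a = card (Y ∩ X)
  b = card (compl Y ∩ X)
  c = card (Y ∩ compl X)
  d = card (compl Y ∩ compl X)
  ∂X = boundary G X
  ∂ᶜY = boundary (complement G) Y
  |X| : card X ≡ a + b
  |X| = trans (card-∩-split X Y) (cong₂ _+_ (card-∩-comm X Y) (card-∩-comm X (compl Y)))
  |Xᶜ| : card (compl X) ≡ c + d
  |Xᶜ| = trans (card-∩-split (compl X) Y) (cong₂ _+_ (card-∩-comm (compl X) Y) (card-∩-comm (compl X) (compl Y)))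
  |Y| : card Y ≡ a + c
  |Y| = card-∩-split Y X
  |Yᶜ| : card (compl Y) ≡ b + d
  |Yᶜ| = card-∩-split (compl Y) X
  sparse′ : suc ∂X ≤ (a + b) ⊓ (c + d)
  sparse′ = ≤-trans sparse (≤-reflexive (cong₂ _⊓_ |X| |Xᶜ|))
  0<|X| : 0 < a + b
  0<|X| = ≤-trans (s≤s z≤n) (≤-trans sparse′ (m⊓n≤m (a + b) (c + d)))
  0<|Xᶜ| : 0 < c + d
  0<|Xᶜ| = ≤-trans (s≤s z≤n) (≤-trans sparse′ (m⊓n≤n (a + b) (c + d)))
  0<|Y|⊓|Yᶜ| : 0 < (a + c) ⊓ (b + d)
  0<|Y|⊓|Yᶜ| = ≤-trans (n≢0⇒n>0 nontrivial) (≤-reflexive (cong₂ _⊓_ |Y| |Yᶜ|))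
  0<|Y| : 0 < a + c
  0<|Y| = ≤-trans 0<|Y|⊓|Yᶜ| (m⊓n≤m (a + c) (b + d))
  0<|Yᶜ| : 0 < b + d
  0<|Yᶜ| = ≤-trans 0<|Y|⊓|Yᶜ| (m⊓n≤n (a + c) (b + d))
  cells≢4 : a + b + (c + d) ≢ 4
  cells≢4 = n≢4 ∘ trans (sym (card+card-compl X)) ∘ trans (cong₂ _+_ |X| |Xᶜ|)

fromEdges : (Fin 6 → Bool) → Graph 4
fromEdges e = record { adj = a ; sym = s ; irrefl = r }
  where
  a : Fin 4 → Fin 4 → Bool
  a 0F 0F = false
  a 0F 1F = e 0F
  a 0F 2F = e 1F
  a 0F 3F = e 2F
  a 1F 0F = e 0F
  a 1F 1F = false
  a 1F 2F = e 3F
  a 1F 3F = e 4F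
  a 2F 0F = e 1F
  a 2F 1F = e 3F
  a 2F 2F = false
  a 2F 3F = e 5F
  a 3F 0F = e 2F
  a 3F 1F = e 4F
  a 3F 2F = e 5F
  a 3F 3F = false
  s : ∀ i j → a i j ≡ a j i
  s 0F 0F = refl
  s 0F 1F = refl
  s 0F 2F = refl
  s 0F 3F = refl
  s 1F 0F = refl
  s 1F 1F = refl
  s 1F 2F = refl
  s 1F 3F = refl
  s 2F 0F = refl
  s 2F 1F = refl
  s 2F 2F = refl
  s 2F 3F = refl
  s 3F 0F = refl
  s 3F 1F = refl
  s 3F 2F = refl
  s 3F 3F = refl
  r : ∀ i → a i i ≡ false
  r 0F = refl
  r 1F = refl
  r 2F = refl
  r 3F = refl

edges : Graph 4 → Fin 6 → Bool
edges G 0F = adj G 0F 1F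
edges G 1F = adj G 0F 2F
edges G 2F = adj G 0F 3F
edges G 3F = adj G 1F 2F
edges G 4F = adj G 1F 3F
edges G 5F = adj G 2F 3F

adj-fromEdges-edges : (G : Graph 4) (i j : Fin 4) → adj (fromEdges (lookup (tabulate (edges G)))) i j ≡ adj G i j
adj-fromEdges-edges G 0F 0F = sym (adj-irrefl G 0F)
adj-fromEdges-edges G 0F 1F = refl
adj-fromEdges-edges G 0F 2F = refl
adj-fromEdges-edges G 0F 3F = refl
adj-fromEdges-edges G 1F 0F = adj-sym G 0F 1F
adj-fromEdges-edges G 1F 1F = sym (adj-irrefl G 1F)
adj-fromEdges-edges G 1F 2F = refl
adj-fromEdges-edges G 1F 3F = refl
adj-fromEdges-edges G 2F 0F = adj-sym G 0F 2F
adj-fromEdges-edges G 2F 1F = adj-sym G 1F 2F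
adj-fromEdges-edges G 2F 2F = sym (adj-irrefl G 2F)
adj-fromEdges-edges G 2F 3F = refl
adj-fromEdges-edges G 3F 0F = adj-sym G 0F 3F
adj-fromEdges-edges G 3F 1F = adj-sym G 1F 3F
adj-fromEdges-edges G 3F 2F = adj-sym G 2F 3F
adj-fromEdges-edges G 3F 3F = sym (adj-irrefl G 3F)

-- Every permutation of Fin 4 is a product (0 a)(1 b)(2 c).
permutations₄ : List (Permutation′ 4)
permutations₄ = do
  a ← allFin 4
  b ← allFin 4
  c ← allFin 4
  [ transpose 0F a ∘ₚ transpose 1F b ∘ₚ transpose 2F c ]

IsoVia : Graph 4 → Permutation′ 4 → Set
IsoVia G π = ∀ i j → adj G i j ≡ adj P4 (π ⟨$⟩ʳ i) (π ⟨$⟩ʳ j)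

isoVia? : (G : Graph 4) (π : Permutation′ 4) → Dec (IsoVia G π)
isoVia? G π = Fin.all? λ i → Fin.all? λ j → adj G i j Bool.≟ adj P4 (π ⟨$⟩ʳ i) (π ⟨$⟩ʳ j)

FourVertexVerdict : Graph 4 → Set
FourVertexVerdict G = Expanding G ⊎ Expanding (complement G) ⊎ Any (IsoVia G) permutations₄

fourVertexVerdict? : (G : Graph 4) → Dec (FourVertexVerdict G)
fourVertexVerdict? G = expanding? G ⊎-dec (expanding? (complement G) ⊎-dec any? (isoVia? G) permutations₄)

fourVertexVerdict : (v : Vec Bool 6) → FourVertexVerdict (fromEdges (lookup v))
fourVertexVerdict v = decidable-stable (fourVertexVerdict? (fromEdges (lookup v))) λ ¬verdict →
  from-no (anySubset? (λ v → ¬? (fourVertexVerdict? (fromEdges (lookup v))))) (v , ¬verdict)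

expanding⊎complement-expanding₄ : (G : Graph 4) → ¬ (G ≅ P4) → Expanding G ⊎ Expanding (complement G)
expanding⊎complement-expanding₄ G G≇P4 = decide (fourVertexVerdict (tabulate (edges G)))
  where
  G′ = fromEdges (lookup (tabulate (edges G)))
  decide : FourVertexVerdict G′ → Expanding G ⊎ Expanding (complement G)
  decide (inj₁ expanding)          = inj₁ (expanding-cong G′ G (adj-fromEdges-edges G) expanding)
  decide (inj₂ (inj₁ expanding))   =
    inj₂ (expanding-cong (complement G′) (complement G) (complement-cong G′ G (adj-fromEdges-edges G)) expanding)
  decide (inj₂ (inj₂ isomorphism)) with (π , π-iso) ← satisfied isomorphism =
    ⊥-elim (G≇P4 (record { bij = π ; preserve = λ i j → trans (sym (adj-fromEdges-edges G i j)) (π-iso i j) }))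

expanding⊎complement-expanding : (G : Graph n) → ¬ (G ≅ P4) → Expanding G ⊎ Expanding (complement G)
expanding⊎complement-expanding {n} G G≇P4 with n ≟ 4
... | yes refl = expanding⊎complement-expanding₄ G G≇P4
... | no n≢4 with expanding⊎sparseCut G
...   | inj₁ expanding    = inj₁ expanding
...   | inj₂ (X , sparse) = inj₂ (sparseCut⇒complement-expanding G X sparse n≢4)

theorem2p4 : (m : ℕ) (G : Graph (suc (suc m))) → ¬ (G ≅ P4) →
    CheegerAtLeast G ((+ 1) / ⌊ suc (suc m) /2⌋) ⊎ CheegerAtLeast (complement G) ((+ 1) / ⌊ suc (suc m) /2⌋)
theorem2p4 m G G≇P4 = Sum.map (expanding⇒cheegerAtLeast G) (expanding⇒cheegerAtLeast (complement G))
  (expanding⊎complement-expanding G G≇P4)
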